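{- Let $q$ be a power of an odd prime and let $n$ be an odd positive integer. If $h_q(n)=0$, then $h_q(2n)=0$.
   Context: For a prime power $q$ and $n\in\mathbb{N}$, let $e_0,\dots,e_{n-1}$ be the standard basis of $\mathbb{F}_q^n$ (indices mod $n$) and let $\tau:\mathbb{F}_q^n\to\mathbb{F}_q^n$ be the cyclic shift $\sum_i a_ie_i\mapsto\sum_i a_ie_{i+1}$. A subspace $U\subseteq\mathbb{F}_q^n$ is cyclically covering if $\bigcup_{i=0}^{n-1}\tau^i(U)=\mathbb{F}_q^n$. $h_q(n)$ denotes the largest codimension of a cyclically covering subspace of $\mathbb{F}_q^n$. -}

module Defs where

open import Level using (0ℓ)
open import Data.Nat using (ℕ; zero; suc)
open import Data.Fin using (Fin; zero; suc; fromℕ; inject₁)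
open import Data.Product using (∃; _×_)
open import Relation.Nullary using (¬_)
open import Relation.Binary.PropositionalEquality using (_≡_)
open import Algebra.Bundles using (CommutativeRing)

record IsFiniteFieldOfSize (F : CommutativeRing 0ℓ 0ℓ) (q : ℕ) : Set where
  open CommutativeRing F
  field
    1≉0       : ¬ (1# ≈ 0#)
    inverse   : ∀ x → ¬ (x ≈ 0#) → ∃ λ y → x * y ≈ 1#
    enum      : Fin q → Carrier
    enum-inj  : ∀ i j → enum i ≈ enum j → i ≡ j
    enum-surj : ∀ x → ∃ λ i → enum i ≈ x

predMod : ∀ {n} → Fin n → Fin n
predMod {suc m} zero    = fromℕ m
predMod {suc m} (suc i) = inject₁ i

module Vectors (F : CommutativeRing 0ℓ 0ℓ) where
  open CommutativeRing F

  Vec' : ℕ → Set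
  Vec' n = Fin n → Carrier

  _≋_ : ∀ {n} → Vec' n → Vec' n → Set
  u ≋ v = ∀ i → u i ≈ v i

  -- the cyclic shift τ (∑ a_i e_i ↦ ∑ a_i e_{i+1}), i.e. (τ a)_j = a_{j-1}
  τ : ∀ {n} → Vec' n → Vec' n
  τ a j = a (predMod j)

  τ^ : ∀ {n} → ℕ → Vec' n → Vec' n
  τ^ zero    a = a
  τ^ (suc k) a = τ (τ^ k a)

  record IsSubspace {n : ℕ} (U : Vec' n → Set) : Set where
    field
      resp  : ∀ {u v} → u ≋ v → U u → U v
      has0  : U (λ _ → 0#)
      add   : ∀ {u v} → U u → U v → U (λ i → u i + v i)
      scale : ∀ c {u} → U u → U (λ i → c * u i)

  CyclicallyCovering : ∀ {n} → (Vec' n → Set) → Set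
  CyclicallyCovering {n} U =
    ∀ (v : Vec' n) → ∃ λ (i : Fin n) → ∃ λ (u : Vec' n) →
      U u × (τ^ (Data.Fin.toℕ i) u ≋ v)

  -- h_q(n) = 0: every cyclically covering subspace of F^n has codimension 0,
  -- i.e. is all of F^n.
  hZero : ℕ → Set₁
  hZero n = ∀ (U : Vec' n → Set) → IsSubspace U → CyclicallyCovering U →
              ∀ (v : Vec' n) → U v

-- If 1 + 1 = 0 in F, then x ↦ x + 1 is a fixed-point-free involution of F, forcing q to be
-- even; so 2 is invertible. Let N = 2n. For η with η ^ N = 1, the twisted periodic embedding
-- (twist η w)_j = η^j w_(j mod n) of F^n into F^N satisfies twist η ∘ τ = η · (τ ∘ twist η),
-- so it pulls a cyclically covering subspace U ⊆ F^N back to a cyclically covering subspace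
-- of F^n, which is all of F^n because h_q(n) = 0. Hence U contains the images of twist 1 and
-- twist (-1). As n is odd, (-1)^j changes sign between the indices j and j + n, so these two
-- images together contain every (x + d, x - d) in F^n × F^n = F^N: all of F^N, as 2 is invertible.
module Submission where

open import Defs
open import Level using (0ℓ)
open import Algebra.Bundles using (CommutativeRing)
open import Data.Nat as ℕ using (ℕ; zero; suc)
import Data.Nat.Properties as ℕₚ
open import Data.Nat.DivMod using (_%_)
open import Data.Nat.Divisibility using (_∣_; divides; ∣-refl; ∣-trans; ∣m∣n⇒∣m+n; m∣m*n; n∣m*n; m%n≡0⇒n∣m; n∣m⇒m%n≡0)
open import Data.Nat.GeneralisedArithmetic using (iterate)
open import Data.Nat.Primality using (Prime)
open import Data.Fin using (Fin; zero; suc; toℕ; remainder; quotient; combine)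
open import Data.Fin.Properties using (toℕ-fromℕ; toℕ-inject₁; toℕ-combine; remQuot-combine; combine-remQuot)
open import Data.Product using (∃₂; _,_; proj₁; proj₂)
open import Function using (_∘_)
open import Relation.Nullary using (¬_; contradiction)
open import Relation.Binary.PropositionalEquality as ≡ using (_≡_; _≢_)

module Parity where

  open import Data.Nat using (_+_; _^_; _<_; _<?_; _≟_; z≤n; s≤s; s≤s⁻¹)
  open import Data.Nat.Properties using (1+n≢n; n<1⇒n≡0; ≤∧≢⇒<; <⇒≢; m<n⇒m<1+n; ≤-refl)
  open import Data.Nat.Divisibility using (∣1⇒≡1)
  open import Data.Nat.Primality using (prime[2]; euclidsLemma)
  open import Data.Fin using (fromℕ<)
  open import Data.Fin.Properties using (toℕ<n; toℕ-fromℕ<; fromℕ<-toℕ; toℕ-injective)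
  open import Data.Sum using ([_,_])
  open import Relation.Nullary using (yes; no)
  open import Relation.Binary.PropositionalEquality using (refl; sym; trans; cong; subst; ≢-sym)

  ¬2∣⇒¬2∣^ : ∀ {p} k → ¬ 2 ∣ p → ¬ 2 ∣ p ^ k
  ¬2∣⇒¬2∣^     zero    2∤p 2∣1      = contradiction (∣1⇒≡1 2∣1) λ ()
  ¬2∣⇒¬2∣^ {p} (suc k) 2∤p 2∣p*pᵏ =
    [ 2∤p , ¬2∣⇒¬2∣^ k 2∤p ] (euclidsLemma p (p ^ k) prime[2] 2∣p*pᵏ)

  -- Stated for functions on ℕ, so that conjugating and restricting need no Fin bookkeeping.
  record FixedPointFreeInvolution (m : ℕ) (g : ℕ → ℕ) : Set where
    field
      closed         : ∀ {x} → x < m → g x < m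
      involutive     : ∀ {x} → x < m → g (g x) ≡ x
      fixedPointFree : ∀ {x} → x < m → g x ≢ x

  swap : ℕ → ℕ → ℕ → ℕ
  swap b c x with x ≟ b | x ≟ c
  ... | yes _ | _     = c
  ... | no _  | yes _ = b
  ... | no _  | no _  = x

  swap-fixes : ∀ {b c x} → x ≢ b → x ≢ c → swap b c x ≡ x
  swap-fixes {b} {c} {x} x≢b x≢c with x ≟ b | x ≟ c
  ... | yes x≡b | _       = contradiction x≡b x≢b
  ... | no _    | yes x≡c = contradiction x≡c x≢c
  ... | no _    | no _    = refl

  swap-left : ∀ b c → swap b c b ≡ c
  swap-left b c with b ≟ b
  ... | yes _  = refl
  ... | no b≢b = contradiction refl b≢b

  swap-right : ∀ b c → swap b c c ≡ b
  swap-right b c with c ≟ b | c ≟ c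
  ... | yes c≡b | _      = c≡b
  ... | no _    | yes _  = refl
  ... | no _    | no c≢c = contradiction refl c≢c

  swap-involutive : ∀ b c x → swap b c (swap b c x) ≡ x
  swap-involutive b c x with x ≟ b | x ≟ c
  ... | yes refl | _        = swap-right x c
  ... | no _     | yes refl = swap-left b x
  ... | no x≢b   | no x≢c   = swap-fixes x≢b x≢c

  swap-closed : ∀ {b c m x} → b < m → c < m → x < m → swap b c x < m
  swap-closed {b} {c} {m} {x} b<m c<m x<m with x ≟ b | x ≟ c
  ... | yes _ | _     = c<m
  ... | no _  | yes _ = b<m
  ... | no _  | no _  = x<m

  conjugate : ∀ {m g t} → FixedPointFreeInvolution m g →
              (∀ {x} → x < m → t x < m) → (∀ x → t (t x) ≡ x) →
              FixedPointFreeInvolution m (t ∘ g ∘ t)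
  conjugate {m} {g} {t} inv t-closed t-involutive = record
    { closed         = t-closed ∘ closed ∘ t-closed
    ; involutive     = λ {x} x<m → trans (cong (t ∘ g) (t-involutive (g (t x))))
                                     (trans (cong t (involutive (t-closed x<m))) (t-involutive x))
    ; fixedPointFree = λ {x} x<m tgtx≡x → fixedPointFree (t-closed x<m)
                                            (trans (sym (t-involutive (g (t x)))) (cong t tgtx≡x))
    }
    where open FixedPointFreeInvolution inv

  restrict : ∀ {m g} → FixedPointFreeInvolution (2 + m) g → g (1 + m) ≡ m →
             FixedPointFreeInvolution m g
  restrict {m} {g} inv g[1+m]≡m = record
    { closed         = λ x<m → ≤∧≢⇒< (s≤s⁻¹ (≤∧≢⇒< (s≤s⁻¹ (closed (lift x<m))) (gx≢1+m x<m))) (gx≢m x<m)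
    ; involutive     = involutive ∘ lift
    ; fixedPointFree = fixedPointFree ∘ lift
    }
    where
    open FixedPointFreeInvolution inv

    lift : ∀ {x} → x < m → x < 2 + m
    lift = m<n⇒m<1+n ∘ m<n⇒m<1+n

    gx≢1+m : ∀ {x} → x < m → g x ≢ 1 + m
    gx≢1+m {x} x<m gx≡1+m =
      <⇒≢ x<m (trans (sym (involutive (lift x<m))) (trans (cong g gx≡1+m) g[1+m]≡m))

    gx≢m : ∀ {x} → x < m → g x ≢ m
    gx≢m {x} x<m gx≡m = <⇒≢ (m<n⇒m<1+n x<m) (trans (sym (involutive (lift x<m)))
      (trans (cong g (trans gx≡m (sym g[1+m]≡m))) (involutive (s≤s ≤-refl))))

  -- Conjugating by the transposition (g (1 + m)) m makes {m, 1 + m} an orbit, which is then removed.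
  fixedPointFreeInvolution⇒even : ∀ m {g} → FixedPointFreeInvolution m g → 2 ∣ m
  fixedPointFreeInvolution⇒even zero          _   = divides 0 refl
  fixedPointFreeInvolution⇒even (suc zero)    inv = contradiction
    (n<1⇒n≡0 (closed (s≤s z≤n))) (fixedPointFree (s≤s z≤n))
    where open FixedPointFreeInvolution inv
  fixedPointFreeInvolution⇒even (suc (suc m)) {g} inv =
    ∣m∣n⇒∣m+n ∣-refl (fixedPointFreeInvolution⇒even m (restrict conjugated t∘g∘t[1+m]≡m))
    where
    open FixedPointFreeInvolution inv
    t = swap (g (suc m)) m

    conjugated : FixedPointFreeInvolution (2 + m) (t ∘ g ∘ t)
    conjugated = conjugate inv (swap-closed (closed ≤-refl) (m<n⇒m<1+n ≤-refl)) (swap-involutive (g (suc m)) m)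

    t∘g∘t[1+m]≡m : t (g (t (suc m))) ≡ m
    t∘g∘t[1+m]≡m = trans (cong (t ∘ g) (swap-fixes (≢-sym (fixedPointFree ≤-refl)) 1+n≢n))
                         (swap-left (g (suc m)) m)

  module _ {m} (f : Fin m → Fin m) where

    private
      extension : ℕ → ℕ
      extension x with x <? m
      ... | yes x<m = toℕ (f (fromℕ< x<m))
      ... | no _    = x

      extension-toℕ : ∀ i → extension (toℕ i) ≡ toℕ (f i)
      extension-toℕ i with toℕ i <? m
      ... | yes i<m = cong (toℕ ∘ f) (fromℕ<-toℕ i i<m)
      ... | no  i≮m = contradiction (toℕ<n i) i≮m

      onFin : {P : ℕ → Set} → (∀ i → P (toℕ i)) → ∀ {x} → x < m → P x
      onFin {P} P-toℕ x<m = subst P (toℕ-fromℕ< x<m) (P-toℕ (fromℕ< x<m))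

    fixedPointFreeInvolution-Fin⇒even : (∀ i → f (f i) ≡ i) → (∀ i → f i ≢ i) → 2 ∣ m
    fixedPointFreeInvolution-Fin⇒even f-involutive f-fixedPointFree =
      fixedPointFreeInvolution⇒even m {extension} record
        { closed         = onFin λ i → subst (_< m) (sym (extension-toℕ i)) (toℕ<n (f i))
        ; involutive     = onFin λ i → trans (cong extension (extension-toℕ i))
                                         (trans (extension-toℕ (f i)) (cong toℕ (f-involutive i)))
        ; fixedPointFree = onFin λ i e →
                             f-fixedPointFree i (toℕ-injective (trans (sym (extension-toℕ i)) e))
        }

module Indices where

  open import Data.Nat using (_+_; _*_; NonZero)
  open import Data.Nat.Properties using (+-identityʳ; +-assoc; +-comm; +-suc; *-assoc; *-comm; ≤-refl; <⇒≤)
  open import Data.Nat.DivMod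
    using (%-distribˡ-+; m%n%n≡m%n; [m+n]%n≡m%n; [m+kn]%n≡m%n; m<n⇒m%n≡m; m≤n⇒m%n≡m; m∣n⇒o%n%m≡o%m)
  open import Data.Fin using (inject₁)
  open import Data.Fin.Properties using (toℕ<n; toℕ-injective)
  open import Relation.Binary.PropositionalEquality using (refl; sym; trans; cong)
  open Relation.Binary.PropositionalEquality.≡-Reasoning

  [m%d+n]%d≡[m+n]%d : ∀ m n d .{{_ : NonZero d}} → (m % d + n) % d ≡ (m + n) % d
  [m%d+n]%d≡[m+n]%d m n d = begin
    (m % d + n) % d         ≡⟨ %-distribˡ-+ (m % d) n d ⟩
    (m % d % d + n % d) % d ≡⟨ cong (λ x → (x + n % d) % d) (m%n%n≡m%n m d) ⟩
    (m % d + n % d) % d     ≡⟨ %-distribˡ-+ m n d ⟨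
    (m + n) % d             ∎

  toℕ-predMod : ∀ {m} (j : Fin (suc m)) → toℕ (predMod j) ≡ (toℕ j + m) % suc m
  toℕ-predMod {m} zero    = trans (toℕ-fromℕ m) (sym (m≤n⇒m%n≡m ≤-refl))
  toℕ-predMod {m} (suc i) = begin
    toℕ (inject₁ i)            ≡⟨ toℕ-inject₁ i ⟩
    toℕ i                      ≡⟨ m≤n⇒m%n≡m (<⇒≤ (toℕ<n i)) ⟨
    toℕ i % suc m              ≡⟨ [m+n]%n≡m%n (toℕ i) (suc m) ⟨
    (toℕ i + suc m) % suc m    ≡⟨ cong (_% suc m) (+-suc (toℕ i) m) ⟩
    (suc (toℕ i) + m) % suc m  ∎

  toℕ-iterate-predMod : ∀ {m} k (j : Fin (suc m)) →
                        toℕ (iterate predMod j k) ≡ (toℕ j + k * m) % suc m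
  toℕ-iterate-predMod {m} zero    j =
    sym (trans (cong (_% suc m) (+-identityʳ (toℕ j))) (m<n⇒m%n≡m (toℕ<n j)))
  toℕ-iterate-predMod {m} (suc k) j = begin
    toℕ (iterate predMod (predMod j) k)       ≡⟨ toℕ-iterate-predMod k (predMod j) ⟩
    (toℕ (predMod j) + k * m) % suc m         ≡⟨ cong (λ x → (x + k * m) % suc m) (toℕ-predMod j) ⟩
    ((toℕ j + m) % suc m + k * m) % suc m     ≡⟨ [m%d+n]%d≡[m+n]%d (toℕ j + m) (k * m) (suc m) ⟩
    (toℕ j + m + k * m) % suc m               ≡⟨ cong (_% suc m) (+-assoc (toℕ j) m (k * m)) ⟩
    (toℕ j + (m + k * m)) % suc m             ∎

  iterate-predMod-periodic : ∀ {m k} → suc m ∣ k → (j : Fin (suc m)) → iterate predMod j k ≡ j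
  iterate-predMod-periodic {m} (divides d refl) j = toℕ-injective (begin
    toℕ (iterate predMod j (d * suc m))     ≡⟨ toℕ-iterate-predMod (d * suc m) j ⟩
    (toℕ j + d * suc m * m) % suc m         ≡⟨ cong (λ x → (toℕ j + x) % suc m) (d*[1+m]*m≡d*m*[1+m]) ⟩
    (toℕ j + d * m * suc m) % suc m         ≡⟨ [m+kn]%n≡m%n (toℕ j) (d * m) (suc m) ⟩
    toℕ j % suc m                           ≡⟨ m<n⇒m%n≡m (toℕ<n j) ⟩
    toℕ j                                   ∎)
    where
    d*[1+m]*m≡d*m*[1+m] : d * suc m * m ≡ d * m * suc m
    d*[1+m]*m≡d*m*[1+m] = trans (*-assoc d (suc m) m)
                            (trans (cong (d *_) (*-comm (suc m) m)) (sym (*-assoc d m (suc m))))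

  toℕ-remainder : ∀ {c} n .{{_ : NonZero n}} (j : Fin (c * n)) → toℕ (remainder {c} n j) ≡ toℕ j % n
  toℕ-remainder {c} n j = begin
    toℕ r                         ≡⟨ m<n⇒m%n≡m (toℕ<n r) ⟨
    toℕ r % n                     ≡⟨ [m+kn]%n≡m%n (toℕ r) (toℕ q) n ⟨
    (toℕ r + toℕ q * n) % n       ≡⟨ cong (_% n) (trans (+-comm (toℕ r) _) (cong (_+ toℕ r) (*-comm (toℕ q) n))) ⟩
    (n * toℕ q + toℕ r) % n       ≡⟨ cong (_% n) (toℕ-combine q r) ⟨
    toℕ (combine q r) % n         ≡⟨ cong (λ i → toℕ i % n) (combine-remQuot {c} n j) ⟩
    toℕ j % n                     ∎
    where
    q = quotient {c} n j
    r = remainder {c} n j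

  remainder-predMod : ∀ {c n} (j : Fin (suc c * suc n)) →
                      remainder {suc c} (suc n) (predMod j) ≡ predMod (remainder {suc c} (suc n) j)
  remainder-predMod {c} {n} j = toℕ-injective (begin
    toℕ (remainder {suc c} (suc n) (predMod j))    ≡⟨ toℕ-remainder {suc c} (suc n) (predMod j) ⟩
    toℕ (predMod j) % suc n                ≡⟨ cong (_% suc n) (toℕ-predMod j) ⟩
    (toℕ j + (n + c * suc n)) % N % suc n  ≡⟨ m∣n⇒o%n%m≡o%m (suc n) N (toℕ j + (n + c * suc n)) (n∣m*n (suc c)) ⟩
    (toℕ j + (n + c * suc n)) % suc n      ≡⟨ cong (_% suc n) (+-assoc (toℕ j) n (c * suc n)) ⟨
    (toℕ j + n + c * suc n) % suc n        ≡⟨ [m+kn]%n≡m%n (toℕ j + n) c (suc n) ⟩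
    (toℕ j + n) % suc n                    ≡⟨ [m%d+n]%d≡[m+n]%d (toℕ j) n (suc n) ⟨
    (toℕ j % suc n + n) % suc n            ≡⟨ cong (λ x → (x + n) % suc n) (toℕ-remainder {suc c} (suc n) j) ⟨
    (toℕ (remainder {suc c} (suc n) j) + n) % suc n ≡⟨ toℕ-predMod (remainder {suc c} (suc n) j) ⟨
    toℕ (predMod (remainder {suc c} (suc n) j))    ∎)
    where
    N = suc c * suc n

open Parity
open Indices

module _ (F : CommutativeRing 0ℓ 0ℓ) where
  open CommutativeRing F hiding (zero)
  open Vectors F
  open import Algebra.Properties.Ring ring using (+-identityʳ-unique; -‿involutive; -‿+-comm; -1*x≈-x; x[y-z]≈xy-xz)
  open import Algebra.Properties.Semiring.Exp semiring using (_^_; ^-congˡ; ^-congʳ; ^-homo-*; ^-assocʳ)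
  open import Algebra.Properties.CommutativeSemigroup +-commutativeSemigroup using () renaming (interchange to +-interchange)
  open import Algebra.Properties.CommutativeSemigroup *-commutativeSemigroup using (x∙yz≈y∙xz) renaming (interchange to *-interchange)
  open import Relation.Binary.Reasoning.Setoid setoid

  1+1≉0 : ∀ {q} → IsFiniteFieldOfSize F q → ¬ 2 ∣ q → ¬ (1# + 1# ≈ 0#)
  1+1≉0 {q} isField 2∤q 1+1≈0 =
    2∤q (fixedPointFreeInvolution-Fin⇒even successor successor-involutive successor-fixedPointFree)
    where
    open IsFiniteFieldOfSize isField

    successor : Fin q → Fin q
    successor i = proj₁ (enum-surj (enum i + 1#))

    enum-successor : ∀ i → enum (successor i) ≈ enum i + 1#
    enum-successor i = proj₂ (enum-surj (enum i + 1#))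

    successor-involutive : ∀ i → successor (successor i) ≡ i
    successor-involutive i = enum-inj _ _ (begin
      enum (successor (successor i)) ≈⟨ enum-successor (successor i) ⟩
      enum (successor i) + 1#        ≈⟨ +-congʳ (enum-successor i) ⟩
      enum i + 1# + 1#               ≈⟨ +-assoc (enum i) 1# 1# ⟩
      enum i + (1# + 1#)             ≈⟨ +-congˡ 1+1≈0 ⟩
      enum i + 0#                    ≈⟨ +-identityʳ (enum i) ⟩
      enum i                         ∎)

    successor-fixedPointFree : ∀ i → successor i ≢ i
    successor-fixedPointFree i sᵢ≡i = 1≉0 (+-identityʳ-unique (enum i) 1#
      (trans (sym (enum-successor i)) (reflexive (≡.cong enum sᵢ≡i))))

  τ^-iterate : ∀ {n} k (v : Vec' n) j → τ^ k v j ≡ v (iterate predMod j k)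
  τ^-iterate zero    v j = ≡.refl
  τ^-iterate (suc k) v j = τ^-iterate k v (predMod j)

  τ^-+ : ∀ {n} a b (v : Vec' n) → τ^ (a ℕ.+ b) v ≡ τ^ a (τ^ b v)
  τ^-+ zero    b v = ≡.refl
  τ^-+ (suc a) b v = ≡.cong τ (τ^-+ a b v)

  τ^-cong : ∀ {n} k {u v : Vec' n} → u ≋ v → τ^ k u ≋ τ^ k v
  τ^-cong zero    u≋v = u≋v
  τ^-cong (suc k) u≋v = τ^-cong k u≋v ∘ predMod

  τ^-periodic : ∀ {m k} → suc m ∣ k → (v : Vec' (suc m)) → τ^ k v ≋ v
  τ^-periodic {k = k} [1+m]∣k v j =
    reflexive (≡.trans (τ^-iterate k v j) (≡.cong v (iterate-predMod-periodic [1+m]∣k j)))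

  η*η^predMod≈η^ : ∀ {m} {η} → η ^ suc m ≈ 1# → (j : Fin (suc m)) → η * η ^ toℕ (predMod j) ≈ η ^ toℕ j
  η*η^predMod≈η^ {m} {η} ηᵐ⁺¹≈1 zero    = trans (*-congˡ (^-congʳ η (toℕ-fromℕ m))) ηᵐ⁺¹≈1
  η*η^predMod≈η^ {m} {η} ηᵐ⁺¹≈1 (suc i) = *-congˡ (^-congʳ η (toℕ-inject₁ i))

  module Twist {c n : ℕ} where

    N = suc c ℕ.* suc n

    reduce : Fin N → Fin (suc n)
    reduce = remainder {suc c} (suc n)

    twist : Carrier → Vec' (suc n) → Vec' N
    twist η w j = η ^ toℕ j * w (reduce j)

    twist-τ : ∀ {η} → η ^ N ≈ 1# → (w : Vec' (suc n)) →
              twist η (τ w) ≋ λ j → η * τ (twist η w) j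
    twist-τ {η} ηᴺ≈1 w j = begin
      η ^ toℕ j * w (predMod (reduce j))                ≈⟨ *-congʳ (η*η^predMod≈η^ ηᴺ≈1 j) ⟨
      η * η ^ toℕ (predMod j) * w (predMod (reduce j))  ≡⟨ ≡.cong (λ i → η * η ^ toℕ (predMod j) * w i)
                                                                  (remainder-predMod {c} {n} j) ⟨
      η * η ^ toℕ (predMod j) * w (reduce (predMod j))  ≈⟨ *-assoc η _ _ ⟩
      η * τ (twist η w) j                               ∎

    twist-τ^ : ∀ {η} → η ^ N ≈ 1# → ∀ k (w : Vec' (suc n)) →
               twist η (τ^ k w) ≋ λ j → η ^ k * τ^ k (twist η w) j
    twist-τ^     ηᴺ≈1 zero    w j = sym (*-identityˡ _)
    twist-τ^ {η} ηᴺ≈1 (suc k) w j = begin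
      twist η (τ (τ^ k w)) j                      ≈⟨ twist-τ ηᴺ≈1 (τ^ k w) j ⟩
      η * twist η (τ^ k w) (predMod j)            ≈⟨ *-congˡ (twist-τ^ ηᴺ≈1 k w (predMod j)) ⟩
      η * (η ^ k * τ^ k (twist η w) (predMod j))  ≈⟨ *-assoc η _ _ ⟨
      η ^ suc k * τ^ (suc k) (twist η w) j        ∎

    pullback-isSubspace : ∀ {U} η → IsSubspace U → IsSubspace (U ∘ twist η)
    pullback-isSubspace η U-subspace = record
      { resp  = λ u≋v → resp (*-congˡ ∘ u≋v ∘ reduce)
      ; has0  = resp (λ _ → sym (zeroʳ _)) has0
      ; add   = λ u∈ v∈ → resp (λ _ → sym (distribˡ _ _ _)) (add u∈ v∈)
      ; scale = λ a u∈ → resp (λ _ → x∙yz≈y∙xz a _ _) (scale a u∈)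
      }
      where open IsSubspace U-subspace

    pullback-cyclicallyCovering : ∀ {U η} → η ^ N ≈ 1# → IsSubspace U → CyclicallyCovering U →
                                  CyclicallyCovering (U ∘ twist η)
    pullback-cyclicallyCovering {U} {η} ηᴺ≈1 U-subspace U-covering w
      with U-covering (twist η w)
    ... | i , u , u∈U , τⁱu≋twist-w = reduce i , τ^ K w , τᴷw∈pullback , τ^reduce-i∘τᴷ≋id
      where
      open IsSubspace U-subspace
      -- N reduces to suc (n + c * suc n), so N * i is definitionally i + K.
      K = (n ℕ.+ c ℕ.* suc n) ℕ.* toℕ i

      N∣i+K : N ∣ toℕ i ℕ.+ K
      N∣i+K = m∣m*n (toℕ i)

      N∣K+i : N ∣ K ℕ.+ toℕ i
      N∣K+i = ≡.subst (N ∣_) (ℕₚ.+-comm (toℕ i) K) N∣i+K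

      τᴷw∈pullback : U (twist η (τ^ K w))
      τᴷw∈pullback = resp ηᴷu≈twist-τᴷw (scale (η ^ K) u∈U)
        where
        ηᴷu≈twist-τᴷw : ∀ j → η ^ K * u j ≈ twist η (τ^ K w) j
        ηᴷu≈twist-τᴷw j = begin
          η ^ K * u j                      ≈⟨ *-congˡ (τ^-periodic N∣K+i u j) ⟨
          η ^ K * τ^ (K ℕ.+ toℕ i) u j     ≡⟨ ≡.cong (λ v → η ^ K * v j) (τ^-+ K (toℕ i) u) ⟩
          η ^ K * τ^ K (τ^ (toℕ i) u) j    ≈⟨ *-congˡ (τ^-cong K τⁱu≋twist-w j) ⟩
          η ^ K * τ^ K (twist η w) j       ≈⟨ twist-τ^ ηᴺ≈1 K w j ⟨
          twist η (τ^ K w) j               ∎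

      τ^reduce-i∘τᴷ≋id : τ^ (toℕ (reduce i)) (τ^ K w) ≋ w
      τ^reduce-i∘τᴷ≋id = ≡.subst (λ v → v ≋ w) (τ^-+ (toℕ (reduce i)) K w) (τ^-periodic n+1∣reduce-i+K w)
        where
        n+1∣reduce-i+K : suc n ∣ toℕ (reduce i) ℕ.+ K
        n+1∣reduce-i+K = m%n≡0⇒n∣m _ (suc n) (≡.trans
          (≡.cong (λ x → (x ℕ.+ K) % suc n) (toℕ-remainder {suc c} (suc n) i))
          (≡.trans ([m%d+n]%d≡[m+n]%d (toℕ i) K (suc n))
                   (n∣m⇒m%n≡0 _ (suc n) (∣-trans (n∣m*n (suc c)) N∣i+K))))

    twist∈ : hZero (suc n) → ∀ {U η} → η ^ N ≈ 1# → IsSubspace U → CyclicallyCovering U →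
             ∀ w → U (twist η w)
    twist∈ hZero-n {U} {η} ηᴺ≈1 U-subspace U-covering = hZero-n (U ∘ twist η)
      (pullback-isSubspace η U-subspace) (pullback-cyclicallyCovering ηᴺ≈1 U-subspace U-covering)

    reduce-combine : ∀ (q : Fin (suc c)) (r : Fin (suc n)) → reduce (combine q r) ≡ r
    reduce-combine q r = ≡.cong proj₂ (remQuot-combine q r)

    twist-combine : ∀ η w (q : Fin (suc c)) (r : Fin (suc n)) →
                    twist η w (combine q r) ≈ (η ^ suc n) ^ toℕ q * (η ^ toℕ r * w r)
    twist-combine η w q r = begin
      η ^ toℕ (combine q r) * w (reduce (combine q r))  ≡⟨ ≡.cong₂ (λ e i → η ^ e * w i)
                                                                    (toℕ-combine q r) (reduce-combine q r) ⟩
      η ^ (suc n ℕ.* toℕ q ℕ.+ toℕ r) * w r            ≈⟨ *-congʳ (^-homo-* η (suc n ℕ.* toℕ q) (toℕ r)) ⟩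
      η ^ (suc n ℕ.* toℕ q) * η ^ toℕ r * w r          ≈⟨ *-congʳ (*-congʳ (^-assocʳ η (suc n) (toℕ q))) ⟨
      (η ^ suc n) ^ toℕ q * η ^ toℕ r * w r            ≈⟨ *-assoc _ _ _ ⟩
      (η ^ suc n) ^ toℕ q * (η ^ toℕ r * w r)          ∎

  1^n≈1 : ∀ k → 1# ^ k ≈ 1#
  1^n≈1 zero    = refl
  1^n≈1 (suc k) = trans (*-identityˡ _) (1^n≈1 k)

  module _ {η} (η*η≈1 : η * η ≈ 1#) where

    η^n*η^n≈1 : ∀ k → η ^ k * η ^ k ≈ 1#
    η^n*η^n≈1 zero    = *-identityˡ 1#
    η^n*η^n≈1 (suc k) = begin
      η * η ^ k * (η * η ^ k)    ≈⟨ *-interchange η (η ^ k) η (η ^ k) ⟩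
      η * η * (η ^ k * η ^ k)    ≈⟨ *-cong η*η≈1 (η^n*η^n≈1 k) ⟩
      1# * 1#                    ≈⟨ *-identityˡ 1# ⟩
      1#                         ∎

    η^[2*n]≈1 : ∀ k → η ^ (2 ℕ.* k) ≈ 1#
    η^[2*n]≈1 k = begin
      η ^ (k ℕ.+ (k ℕ.+ 0))  ≈⟨ ^-homo-* η k (k ℕ.+ 0) ⟩
      η ^ k * η ^ (k ℕ.+ 0)  ≈⟨ *-congˡ (^-congʳ η (ℕₚ.+-identityʳ k)) ⟩
      η ^ k * η ^ k          ≈⟨ η^n*η^n≈1 k ⟩
      1#                     ∎

    η^n*[η^n*x]≈x : ∀ k x → η ^ k * (η ^ k * x) ≈ x
    η^n*[η^n*x]≈x k x = begin
      η ^ k * (η ^ k * x)  ≈⟨ *-assoc _ _ x ⟨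
      η ^ k * η ^ k * x    ≈⟨ *-congʳ (η^n*η^n≈1 k) ⟩
      1# * x               ≈⟨ *-identityˡ x ⟩
      x                    ∎

  -1*-1≈1 : - 1# * - 1# ≈ 1#
  -1*-1≈1 = trans (-1*x≈-x (- 1#)) (-‿involutive 1#)

  [-1]^odd≈-1 : ∀ k → ¬ 2 ∣ k → (- 1#) ^ k ≈ - 1#
  [-1]^odd≈-1 zero                2∤0   = contradiction (divides 0 ≡.refl) 2∤0
  [-1]^odd≈-1 (suc zero)          _     = *-identityʳ (- 1#)
  [-1]^odd≈-1 (suc (suc k))       2∤2+k = begin
    - 1# * (- 1# * (- 1#) ^ k)  ≈⟨ *-assoc _ _ _ ⟨
    - 1# * - 1# * (- 1#) ^ k    ≈⟨ *-congʳ -1*-1≈1 ⟩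
    1# * (- 1#) ^ k             ≈⟨ *-identityˡ _ ⟩
    (- 1#) ^ k                  ≈⟨ [-1]^odd≈-1 k (2∤2+k ∘ ∣m∣n⇒∣m+n ∣-refl) ⟩
    - 1#                        ∎

  module _ {h} (2*h≈1 : (1# + 1#) * h ≈ 1#) where

    h*[a+a]≈a : ∀ a → h * (a + a) ≈ a
    h*[a+a]≈a a = begin
      h * (a + a)              ≈⟨ *-congˡ (+-cong (*-identityˡ a) (*-identityˡ a)) ⟨
      h * (1# * a + 1# * a)    ≈⟨ *-congˡ (distribʳ a 1# 1#) ⟨
      h * ((1# + 1#) * a)      ≈⟨ *-assoc h _ a ⟨
      h * (1# + 1#) * a        ≈⟨ *-congʳ (trans (*-comm h _) 2*h≈1) ⟩
      1# * a                   ≈⟨ *-identityˡ a ⟩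
      a                        ∎

    h*[a+b]+h*[a-b]≈a : ∀ a b → h * (a + b) + h * (a - b) ≈ a
    h*[a+b]+h*[a-b]≈a a b = begin
      h * (a + b) + h * (a - b)  ≈⟨ distribˡ h _ _ ⟨
      h * (a + b + (a - b))      ≈⟨ *-congˡ (+-interchange a b a (- b)) ⟩
      h * (a + a + (b - b))      ≈⟨ *-congˡ (trans (+-congˡ (-‿inverseʳ b)) (+-identityʳ _)) ⟩
      h * (a + a)                ≈⟨ h*[a+a]≈a a ⟩
      a                          ∎

    h*[a+b]-h*[a-b]≈b : ∀ a b → h * (a + b) - h * (a - b) ≈ b
    h*[a+b]-h*[a-b]≈b a b = begin
      h * (a + b) - h * (a - b)    ≈⟨ x[y-z]≈xy-xz h _ _ ⟨
      h * (a + b - (a - b))        ≈⟨ *-congˡ (+-congˡ (sym (-‿+-comm a (- b)))) ⟩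
      h * (a + b + (- a + - - b))  ≈⟨ *-congˡ (+-congˡ (+-congˡ (-‿involutive b))) ⟩
      h * (a + b + (- a + b))      ≈⟨ *-congˡ (+-interchange a b (- a) b) ⟩
      h * (a - a + (b + b))        ≈⟨ *-congˡ (trans (+-congʳ (-‿inverseʳ a)) (+-identityˡ _)) ⟩
      h * (b + b)                  ≈⟨ h*[a+a]≈a b ⟩
      b                            ∎

  module _ {n} (2∤n+1 : ¬ 2 ∣ suc n) {h} (2*h≈1 : (1# + 1#) * h ≈ 1#) where
    open Twist {1} {n}

    twist-sum-surjective : (v : Vec' N) → ∃₂ λ x y → v ≋ λ j → twist 1# x j + twist (- 1#) y j
    twist-sum-surjective v = x , y , λ j →
      ≡.subst (λ i → v i ≈ twist 1# x i + twist (- 1#) y i) (combine-remQuot {2} (suc n) j)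
              (trans (v≈x±d (quotient {2} (suc n) j) (remainder {2} (suc n) j))
                     (sym (twists≈x±d (quotient {2} (suc n) j) (remainder {2} (suc n) j))))
      where
      a b x d y : Vec' (suc n)
      a r = v (combine {2} zero r)
      b r = v (combine {2} (suc zero) r)
      x r = h * (a r + b r)
      d r = h * (a r - b r)
      y r = (- 1#) ^ toℕ r * d r

      v≈x±d : ∀ (q : Fin 2) r → v (combine q r) ≈ x r + (- 1#) ^ toℕ q * d r
      v≈x±d zero       r = sym (trans (+-congˡ (*-identityˡ (d r))) (h*[a+b]+h*[a-b]≈a 2*h≈1 (a r) (b r)))
      v≈x±d (suc zero) r = sym (trans (+-congˡ (trans (*-congʳ (*-identityʳ (- 1#))) (-1*x≈-x (d r))))
                                       (h*[a+b]-h*[a-b]≈b 2*h≈1 (a r) (b r)))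

      twists≈x±d : ∀ (q : Fin 2) r → twist 1# x (combine q r) + twist (- 1#) y (combine q r) ≈ x r + (- 1#) ^ toℕ q * d r
      twists≈x±d q r = +-cong
        (trans (*-congʳ (1^n≈1 (toℕ (combine q r)))) (trans (*-identityˡ _) (reflexive (≡.cong x (reduce-combine q r)))))
        (begin
          twist (- 1#) y (combine q r)                        ≈⟨ twist-combine (- 1#) y q r ⟩
          ((- 1#) ^ suc n) ^ toℕ q * ((- 1#) ^ toℕ r * y r)   ≈⟨ *-cong (^-congˡ (toℕ q) ([-1]^odd≈-1 (suc n) 2∤n+1))
                                                                       (η^n*[η^n*x]≈x -1*-1≈1 (toℕ r) (d r)) ⟩
          (- 1#) ^ toℕ q * d r                                ∎)

  hZero[n]⇒hZero[2n] : ∀ {n h} → ¬ 2 ∣ suc n → (1# + 1#) * h ≈ 1# → hZero (suc n) → hZero (2 ℕ.* suc n)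
  hZero[n]⇒hZero[2n] {n} 2∤n+1 2*h≈1 hZero-n U U-subspace U-covering v =
    resp (sym ∘ v≋sum) (add (twist∈ hZero-n (1^n≈1 N) U-subspace U-covering x)
                            (twist∈ hZero-n (η^[2*n]≈1 -1*-1≈1 (suc n)) U-subspace U-covering y))
    where
    open Twist {1} {n}
    open IsSubspace U-subspace
    decomposition = twist-sum-surjective 2∤n+1 2*h≈1 v
    x = proj₁ decomposition
    y = proj₁ (proj₂ decomposition)
    v≋sum = proj₂ (proj₂ decomposition)

open import Data.Nat using (_*_; _^_; _≤_)

theorem3p8 : (p k q : ℕ) → Prime p → ¬ (2 ∣ p) → 1 ≤ k → q ≡ p ^ k →
    (F : CommutativeRing 0ℓ 0ℓ) → IsFiniteFieldOfSize F q →
    (n : ℕ) → 1 ≤ n → ¬ (2 ∣ n) →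
    Vectors.hZero F n → Vectors.hZero F (2 * n)
theorem3p8 _ _ _ _ _   _ _    _ _       zero    () _
theorem3p8 p k q _ 2∤p _ q≡pᵏ F isField (suc n) _  2∤n+1 =
  hZero[n]⇒hZero[2n] F 2∤n+1 (proj₂ (inverse (1# + 1#) (1+1≉0 F isField 2∤q)))
  where
  open CommutativeRing F hiding (zero)
  open IsFiniteFieldOfSize isField
  2∤q : ¬ 2 ∣ q
  2∤q = ≡.subst (λ m → ¬ 2 ∣ m) (≡.sym q≡pᵏ) (¬2∣⇒¬2∣^ k 2∤p)
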